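{- For every $\delta\ge \tfrac12$, no deterministic online algorithm for the Online Simple Knapsack problem with item size estimates and additive estimate accuracy $\delta$ has a constant (finite) competitive ratio.
   Context: Online Simple Knapsack with Item Size Estimates (additive accuracy $\delta\ge 0$): an instance consists of actual item sizes $x_1,\dots,x_n\in[0,1]$ together with estimated sizes $x_1',\dots,x_n'$ satisfying $x_i'-\delta\le x_i\le x_i'+\delta$ for all $i$. A deterministic online algorithm knows $\delta$ and the whole list of estimates from the start. The actual sizes are then revealed one at a time in order. When $x_i$ is revealed, the algorithm must irrevocably either pack it into an initially empty knapsack of capacity $1$ (allowed only if the total size already packed plus $x_i$ is at most $1$) or reject it. The gain of an algorithm is the total size of the packed items; $\mathrm{OPT}$ is the maximum total size of a subset of the actual items with total at most $1$. The competitive ratio of an algorithm $A$ is $\sup \mathrm{OPT}/\mathrm{gain}_A$ over all instances with accuracy $\delta$ (a ratio with positive $\mathrm{OPT}$ and zero gain counts as $\infty$).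
   Formalization: The accuracy δ ranges only over rationals at least ½, and the actual and estimated item sizes, in instances and as algorithm inputs, are taken in ℚ instead of the reals. -}

module Defs where

open import Data.Bool using (Bool; true; false; if_then_else_; _∧_)
open import Data.List using (List; []; _∷_; foldr)
open import Data.List.Relation.Unary.All using (All)
open import Data.List.Relation.Binary.Pointwise using (Pointwise)
open import Data.List.Relation.Binary.Sublist.Propositional using (_⊆_)
open import Data.Product using (_×_; ∃)
open import Data.Rational using (ℚ; 0ℚ; 1ℚ; _+_; _-_; _*_; _≤_; _≤ᵇ_)

total : List ℚ → ℚ
total = foldr _+_ 0ℚ

-- A deterministic online algorithm (for a fixed, known accuracy δ).
-- When an item arrives it is given
--   * the full list of estimated sizes x'_1 … x'_n (known from the start), and
--   * the actual sizes revealed so far, most recent first: x_i ∷ x_{i-1} ∷ … ∷ x_1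
--     (x_i is the item currently being decided on).
-- It answers true = "pack", false = "reject".  Its own earlier decisions are
-- determined by this data, so they need not be passed explicitly.
Algorithm : Set
Algorithm = List ℚ → List ℚ → Bool

run : Algorithm → List ℚ → List ℚ → ℚ → List ℚ → ℚ
run A est past load [] = load
run A est past load (x ∷ xs) =
  if A est (x ∷ past) ∧ (load + x ≤ᵇ 1ℚ)
  then run A est (x ∷ past) (load + x) xs
  else run A est (x ∷ past) load xs

gain : Algorithm → List ℚ → List ℚ → ℚ
gain A est xs = run A est [] 0ℚ xs

ValidInstance : ℚ → List ℚ → List ℚ → Set
ValidInstance δ est xs =
  All (λ x → 0ℚ ≤ x × x ≤ 1ℚ) xs ×
  Pointwise (λ e x → e - δ ≤ x × x ≤ e + δ) est xs

-- A has finite competitive ratio: there is a constant c with OPT ≤ c · gain on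
-- every valid instance, where OPT is the maximum total of a feasible subset of the
-- actual items; "OPT ≤ c · gain" is written as "every subset of total ≤ 1 has
-- total ≤ c · gain".  (gain = 0 < OPT counts as ratio ∞ and is excluded.)
FiniteCompetitiveRatio : ℚ → Algorithm → Set
FiniteCompetitiveRatio δ A =
  ∃ λ (c : ℚ) → ∀ (est xs : List ℚ) → ValidInstance δ est xs →
    ∀ (S : List ℚ) → S ⊆ xs → total S ≤ 1ℚ → total S ≤ c * gain A est xs

-- With δ ≥ ½ an estimate of ½ carries no information: every size in [0,1] is
-- consistent with it.  Announce two items of estimate ½ and reveal a tiny first
-- item ε.  If the algorithm rejects it, the second item is 0: the gain is 0 while
-- OPT ≥ ε.  If it accepts, the second item is 1, which no longer fits: the gain is
-- ε while OPT = 1.  Since ε may be chosen after the claimed ratio c, with c·ε < 1,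
-- neither case allows OPT ≤ c · gain.
module Submission where

open import Defs
open import Data.Rational using (ℚ; ½; _≤_)
open import Relation.Nullary using (¬_)

open import Data.Bool using (true; false)
open import Data.Bool.Properties using (T-≡; ¬-not)
open import Data.List using ([]; _∷_; map)
open import Data.List.Relation.Unary.All using (All; []; _∷_)
open import Data.List.Relation.Binary.Pointwise using ([]; _∷_)
open import Data.List.Relation.Binary.Sublist.Propositional using ([]; _∷_; _∷ʳ_)
open import Data.Product using (_×_; _,_; ∃)
open import Data.Rational using (0ℚ; 1ℚ; _+_; _-_; _*_; _<_; _≤ᵇ_; 1/_; Positive; positive)
open import Data.Rational.Properties
open import Data.Sum using (inj₁; inj₂)
open import Function using (const; Equivalence)
open import Relation.Binary.PropositionalEquality using (_≡_; refl; cong; sym; module ≡-Reasoning)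
open import Relation.Nullary.Decidable using (toWitness)

0≤1 : 0ℚ ≤ 1ℚ
0≤1 = toWitness {a? = 0ℚ ≤? 1ℚ} _

½<1 : ½ < 1ℚ
½<1 = toWitness {a? = ½ <? 1ℚ} _

∃ε>0[ε≤1×c*ε<1] : ∀ c → ∃ λ ε → 0ℚ < ε × ε ≤ 1ℚ × c * ε < 1ℚ
∃ε>0[ε≤1×c*ε<1] c with ≤-total c 1ℚ
... | inj₁ c≤1 = ½ , positive⁻¹ ½ , <⇒≤ ½<1 ,
  ≤-<-trans (*-monoʳ-≤-nonNeg ½ c≤1) (≤-<-trans (≤-reflexive (*-identityˡ ½)) ½<1)
... | inj₂ 1≤c = ε , positive⁻¹ ε , ε≤1 , ≤-<-trans (≤-reflexive c*ε≡½) ½<1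
  where
    instance
      c-pos : Positive c
      c-pos = positive (<-≤-trans (positive⁻¹ 1ℚ) 1≤c)
      c-nonZero = pos⇒nonZero c
      1/c-pos = 1/pos⇒pos c

    ε : ℚ
    ε = ½ * 1/ c

    instance
      ε-pos : Positive ε
      ε-pos = pos*pos⇒pos ½ (1/ c)
      ε-nonNeg = pos⇒nonNeg ε

    c*ε≡½ : c * ε ≡ ½
    c*ε≡½ = begin
      c * (½ * 1/ c) ≡⟨ cong (c *_) (*-comm ½ (1/ c)) ⟩
      c * (1/ c * ½) ≡⟨ sym (*-assoc c (1/ c) ½) ⟩
      c * 1/ c * ½   ≡⟨ cong (_* ½) (*-inverseʳ c) ⟩
      1ℚ * ½         ≡⟨ *-identityˡ ½ ⟩
      ½              ∎
      where open ≡-Reasoning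

    ε≤1 : ε ≤ 1ℚ
    ε≤1 = ≤-trans (≤-reflexive (sym (*-identityˡ ε)))
            (≤-trans (*-monoʳ-≤-nonNeg ε 1≤c) (≤-trans (≤-reflexive c*ε≡½) (<⇒≤ ½<1)))

module _ {δ : ℚ} (½≤δ : ½ ≤ δ) where

  ½-within-δ : ∀ {x} → 0ℚ ≤ x → x ≤ 1ℚ → ½ - δ ≤ x × x ≤ ½ + δ
  ½-within-δ 0≤x x≤1 =
    ≤-trans (+-monoʳ-≤ ½ (neg-antimono-≤ ½≤δ)) 0≤x , ≤-trans x≤1 (+-monoʳ-≤ ½ ½≤δ)

  valid-½-estimates : ∀ {xs} → All (λ x → 0ℚ ≤ x × x ≤ 1ℚ) xs →
                      ValidInstance δ (map (const ½) xs) xs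
  valid-½-estimates []                     = [] , []
  valid-½-estimates ((0≤x , x≤1) ∷ bounds) with valid-½-estimates bounds
  ... | sizes , estimates = (0≤x , x≤1) ∷ sizes , ½-within-δ 0≤x x≤1 ∷ estimates

≤ᵇ-true : ∀ {p q} → p ≤ q → (p ≤ᵇ q) ≡ true
≤ᵇ-true p≤q = Equivalence.to T-≡ (≤⇒≤ᵇ p≤q)

≤ᵇ-false : ∀ {p q} → q < p → (p ≤ᵇ q) ≡ false
≤ᵇ-false q<p = ¬-not (λ p≤ᵇq → <-irrefl refl (<-≤-trans q<p (≤ᵇ⇒≤ (Equivalence.from T-≡ p≤ᵇq))))

gain-after-reject : ∀ A est x → A est (x ∷ []) ≡ false → gain A est (x ∷ 0ℚ ∷ []) ≡ 0ℚ
gain-after-reject A est x rejects rewrite rejects with A est (0ℚ ∷ x ∷ [])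
... | true  = refl
... | false = refl

gain-after-accept : ∀ A est x → 0ℚ < x → x ≤ 1ℚ → A est (x ∷ []) ≡ true →
                    gain A est (x ∷ 1ℚ ∷ []) ≡ x
gain-after-accept A est x 0<x x≤1 accepts
  rewrite accepts | ≤ᵇ-true (≤-trans (≤-reflexive (+-identityˡ x)) x≤1)
  with A est (1ℚ ∷ x ∷ [])
... | false = +-identityˡ x
... | true rewrite ≤ᵇ-false (+-monoˡ-< 1ℚ (<-≤-trans 0<x (≤-reflexive (sym (+-identityˡ x)))))
  = +-identityˡ x

theorem7 : ∀ (δ : ℚ) → ½ ≤ δ → ∀ (A : Algorithm) → ¬ FiniteCompetitiveRatio δ A
theorem7 δ ½≤δ A (c , ratio) with ∃ε>0[ε≤1×c*ε<1] c
... | ε , 0<ε , ε≤1 , c*ε<1 with A (½ ∷ ½ ∷ []) (ε ∷ []) in decision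
... | false = <-irrefl refl (<-≤-trans 0<ε (begin
  ε                                      ≡⟨ sym (+-identityʳ ε) ⟩
  total (ε ∷ [])                         ≤⟨ ratio _ _ (valid-½-estimates ½≤δ ((<⇒≤ 0<ε , ε≤1) ∷ (≤-refl , 0≤1) ∷ []))
                                                  (ε ∷ []) (refl ∷ 0ℚ ∷ʳ []) (≤-trans (≤-reflexive (+-identityʳ ε)) ε≤1) ⟩
  c * gain A (½ ∷ ½ ∷ []) (ε ∷ 0ℚ ∷ []) ≡⟨ cong (c *_) (gain-after-reject A _ ε decision) ⟩
  c * 0ℚ                                 ≡⟨ *-zeroʳ c ⟩
  0ℚ                                     ∎))
  where open ≤-Reasoning
... | true = <-irrefl refl (≤-<-trans (begin
  1ℚ                                     ≤⟨ ratio _ _ (valid-½-estimates ½≤δ ((<⇒≤ 0<ε , ε≤1) ∷ (0≤1 , ≤-refl) ∷ []))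
                                                  (1ℚ ∷ []) (ε ∷ʳ refl ∷ []) ≤-refl ⟩
  c * gain A (½ ∷ ½ ∷ []) (ε ∷ 1ℚ ∷ []) ≡⟨ cong (c *_) (gain-after-accept A _ ε 0<ε ε≤1 decision) ⟩
  c * ε                                  ∎) c*ε<1)
  where open ≤-Reasoning
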